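{- There exists $y_o\in Y_{Q,n}$ such that $\{\alpha^\vee_{[n]},y_o\}$ is a $\mathbb{Z}$-basis of the lattice $Y_{Q,n}$.
   Context: $G=\mathrm{GL}_2$ with cocharacter lattice $Y=\mathbb{Z}e_1\oplus\mathbb{Z}e_2$ and positive coroot $\alpha^\vee=e_1-e_2$. $Q$ is a Weyl-invariant integer-valued quadratic form on $Y$ with $Q(e_1)=Q(e_2)=\mathbf{p}$ and $B_Q(e_1,e_2)=\mathbf{q}$, where $B_Q(y_1,y_2)=Q(y_1+y_2)-Q(y_1)-Q(y_2)$; thus $Q(\alpha^\vee)=2\mathbf{p}-\mathbf{q}$. $n\ge1$ is an integer, $n_\alpha=n/\gcd(n,2\mathbf{p}-\mathbf{q})$, $\alpha^\vee_{[n]}=n_\alpha\alpha^\vee$, and $Y_{Q,n}=\{y\in Y: B_Q(y,y')\in n\mathbb{Z}\ \forall y'\in Y\}$. -}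

module Defs where

open import Data.Nat using (ℕ; NonZero; ≢-nonZero; ≢-nonZero⁻¹)
open import Data.Nat.DivMod using (_/_)
open import Data.Nat.GCD using (gcd; gcd[m,n]≢0)
open import Data.Integer as ℤ using (ℤ; +_; _+_; _-_; _*_; ∣_∣)
open import Data.Integer.Divisibility using (_∣_)
open import Data.Product using (_×_; _,_; Σ; ∃)
open import Data.Sum using (inj₁)
open import Relation.Binary.PropositionalEquality using (_≡_)

-- The cocharacter lattice Y = ℤ e₁ ⊕ ℤ e₂ of GL₂, as pairs of integers.
Y : Set
Y = ℤ × ℤ

e₁ e₂ : Y
e₁ = (+ 1 , + 0)
e₂ = (+ 0 , + 1)

_⊕_ : Y → Y → Y
(a , b) ⊕ (c , d) = (a + c , b + d)

_·_ : ℤ → Y → Y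
k · (a , b) = (k * a , k * b)

α∨ : Y
α∨ = (+ 1 , ℤ.- (+ 1))

-- The Weyl-invariant integer quadratic form with Q(e₁) = Q(e₂) = p, B_Q(e₁,e₂) = q:
-- Q(a e₁ + b e₂) = p a² + q a b + p b².
Q : (p q : ℤ) → Y → ℤ
Q p q (a , b) = p * (a * a) + q * (a * b) + p * (b * b)

B : (p q : ℤ) → Y → Y → ℤ
B p q y₁ y₂ = Q p q (y₁ ⊕ y₂) - Q p q y₁ - Q p q y₂

Y[_,_,_] : (p q : ℤ) (n : ℕ) → Y → Set
Y[ p , q , n ] y = ∀ (y' : Y) → (+ n) ∣ B p q y y'

gcd-nonZero : ∀ n k → .{{NonZero n}} → NonZero (gcd n k)
gcd-nonZero n k = ≢-nonZero (gcd[m,n]≢0 n k (inj₁ (≢-nonZero⁻¹ n)))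

nα : (p q : ℤ) (n : ℕ) → .{{NonZero n}} → ℕ
nα p q n = _/_ n (gcd n ∣ (+ 2) * p - q ∣) {{gcd-nonZero n ∣ (+ 2) * p - q ∣}}

α∨[_,_,_] : (p q : ℤ) (n : ℕ) → .{{NonZero n}} → Y
α∨[ p , q , n ] = (+ nα p q n) · α∨

IsℤBasis : (L : Y → Set) → Y → Y → Set
IsℤBasis L v w =
  L v × L w
  × (∀ y → L y → Σ ℤ λ a → Σ ℤ λ b → (a · v) ⊕ (b · w) ≡ y)
  × (∀ a b → (a · v) ⊕ (b · w) ≡ (+ 0 , + 0) → (a ≡ + 0) × (b ≡ + 0))

-- With σ(a, b) = a + b, the kernel of σ on Y_{Q,n} consists of the z α^∨ with
-- n ∣ z (2p − q), i.e. with n_α ∣ z, so it is generated by α^∨_[n]; and σ(Y_{Q,n}) is a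
-- nonzero subgroup of ℤ (it contains n). Any y₀ ∈ Y_{Q,n} whose σ-value generates this
-- subgroup completes α^∨_[n] to a basis. Such a y₀ is one of least positive σ-value; it
-- can be searched for because n Y ⊆ Y_{Q,n} leaves finitely many candidates for each value.
{-# OPTIONS --safe #-}
module Submission where

open import Defs
open import Data.Nat.Base as ℕ using (ℕ; NonZero; suc; zero)
import Data.Nat.Properties as ℕ
import Data.Nat.Divisibility as ℕ
open import Data.Nat.DivMod using (_/_; m/n*n≡m)
open import Data.Nat.GCD using (gcd; gcd[m,n]∣m; gcd[m,n]∣n; m/gcd[m,n]≢0)
open import Data.Nat.Coprimality using (coprime-/gcd; coprime-divisor)
open import Data.Nat.Induction using (<-wellFounded)
import Data.Nat.Tactic.RingSolver as ℕ-Solver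
open import Induction.WellFounded using (Acc; acc)
open import Data.Integer.Base using (ℤ; +_; -_; _+_; _-_; _*_; ∣_∣; 0ℤ)
import Data.Integer.Properties as ℤ
open import Data.Integer.Divisibility.Signed
open import Data.Integer.DivMod using (_%ℕ_; _/ℕ_; a≡a%ℕn+[a/ℕn]*n; n%ℕd<d)
open import Data.Integer.Tactic.RingSolver using (solve-∀)
open import Data.Fin.Base using (Fin; toℕ; fromℕ<)
open import Data.Fin.Properties using (any?; toℕ-fromℕ<)
open import Data.Product.Base using (Σ; ∃; _×_; _,_; proj₁; proj₂)
open import Data.Sum.Base using (inj₁; inj₂)
open import Function.Bundles using (_⇔_; mk⇔; Equivalence)
open import Relation.Nullary using (Dec; yes; no; ¬_; contradiction)
open import Relation.Nullary.Decidable using (_×-dec_; map′)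
open import Relation.Binary.PropositionalEquality

open _∣_ using (quotient; equality)
open Equivalence using (to; from)

_∙_ : Y → Y → ℤ
(r , s) ∙ (a , b) = r * a + s * b

∙-· : ∀ x k y → x ∙ (k · y) ≡ k * (x ∙ y)
∙-· (r , s) k (a , b) = identity r s k a b
  where
  identity : ∀ r s k a b → r * (k * a) + s * (k * b) ≡ k * (r * a + s * b)
  identity = solve-∀

∙-linear : ∀ x i y j z → x ∙ ((i · y) ⊕ (j · z)) ≡ i * (x ∙ y) + j * (x ∙ z)
∙-linear (r , s) i (a , b) j (c , d) = identity r s i a b j c d
  where
  identity : ∀ r s i a b j c d →
    r * (i * a + j * c) + s * (i * b + j * d) ≡ i * (r * a + s * b) + j * (r * c + s * d)
  identity = solve-∀

e₁∙ : ∀ v → e₁ ∙ v ≡ proj₁ v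
e₁∙ (a , b) = identity a b
  where
  identity : ∀ a b → + 1 * a + + 0 * b ≡ a
  identity = solve-∀

e₂∙ : ∀ v → e₂ ∙ v ≡ proj₂ v
e₂∙ (a , b) = identity a b
  where
  identity : ∀ a b → + 0 * a + + 1 * b ≡ b
  identity = solve-∀

·-assoc : ∀ i j y → i · (j · y) ≡ (i * j) · y
·-assoc i j (a , b) = cong₂ _,_ (sym (ℤ.*-assoc i j a)) (sym (ℤ.*-assoc i j b))

y-kw+kw≡y : ∀ y k w → (((+ 1) · y) ⊕ ((- k) · w)) ⊕ (k · w) ≡ y
y-kw+kw≡y (a , b) k (c , d) = cong₂ _,_ (identity a k c) (identity b k d)
  where
  identity : ∀ a k c → (+ 1 * a + - k * c) + k * c ≡ a
  identity = solve-∀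

LinearlyClosed : (Y → Set) → Set
LinearlyClosed L = ∀ i j {y z} → L y → L z → L ((i · y) ⊕ (j · z))

σ : Y → ℤ
σ = (+ 1 , + 1) ∙_

σ-linear : ∀ i y j z → σ ((i · y) ⊕ (j · z)) ≡ i * σ y + j * σ z
σ-linear = ∙-linear (+ 1 , + 1)

σ-α∨ : ∀ z → σ (z · α∨) ≡ 0ℤ
σ-α∨ = identity
  where
  identity : ∀ z → + 1 * (z * + 1) + + 1 * (z * - + 1) ≡ 0ℤ
  identity = solve-∀

σ≡0⇒≡·α∨ : ∀ y → σ y ≡ 0ℤ → y ≡ proj₁ y · α∨
σ≡0⇒≡·α∨ (a , b) σ≡0 = cong₂ _,_ (sym (ℤ.*-identityʳ a)) (begin
  b                              ≡⟨ identity a b ⟩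
  (+ 1 * a + + 1 * b) + a * - + 1 ≡⟨ cong (_+ a * - + 1) σ≡0 ⟩
  0ℤ + a * - + 1                 ≡⟨ ℤ.+-identityˡ (a * - + 1) ⟩
  a * - + 1                      ∎)
  where
  open ≡-Reasoning
  identity : ∀ a b → b ≡ (+ 1 * a + + 1 * b) + a * - + 1
  identity = solve-∀

i*k≡0⇒i≡0 : ∀ {i k} → k ≢ 0ℤ → i * k ≡ 0ℤ → i ≡ 0ℤ
i*k≡0⇒i≡0 {i} k≢0 ik≡0 with ℤ.i*j≡0⇒i≡0∨j≡0 i ik≡0
... | inj₁ i≡0 = i≡0
... | inj₂ k≡0 = contradiction k≡0 k≢0

+[1+n]≢0 : ∀ {n} → + suc n ≢ 0ℤ
+[1+n]≢0 ()

least-witness : ∀ {P : ℕ → Set} → (∀ k → Dec (P k)) → ∀ {m} → P m →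
  ∃ λ k → P k × (∀ {j} → j ℕ.< k → ¬ P j)
least-witness {P} P? {m} Pm = go m (<-wellFounded m) Pm
  where
  go : ∀ m → Acc ℕ._<_ m → P m → ∃ λ k → P k × (∀ {j} → j ℕ.< k → ¬ P j)
  go m (acc smaller) Pm with ℕ.anyUpTo? P? m
  ... | yes (j , j<m , Pj) = go j (smaller j<m) Pj
  ... | no ∄j<m            = m , Pm , λ j<m Pj → ∄j<m (_ , j<m , Pj)

σImage : (Y → Set) → ℤ → Set
σImage L s = ∃ λ y → L y × σ y ≡ s

module _ {L : Y → Set} (closed : LinearlyClosed L) where

  isℤBasis-by-σ : ∀ {N y₀} → L (N · α∨) → L y₀ →
    (∀ {z} → L (z · α∨) → N ∣ z) → (∀ {y} → L y → σ y₀ ∣ σ y) →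
    N ≢ 0ℤ → σ y₀ ≢ 0ℤ → IsℤBasis L (N · α∨) y₀
  isℤBasis-by-σ {N} {y₀} Lv Ly₀ N∣ker σy₀∣σ N≢0 σy₀≢0 = Lv , Ly₀ , span , independent
    where
    open ≡-Reasoning

    span : ∀ y → L y → Σ ℤ λ a → Σ ℤ λ b → (a · (N · α∨)) ⊕ (b · y₀) ≡ y
    span y Ly = a , b , (begin
      (a · (N · α∨)) ⊕ (b · y₀)     ≡⟨ cong (_⊕ (b · y₀)) (·-assoc a N α∨) ⟩
      ((a * N) · α∨) ⊕ (b · y₀)     ≡⟨ cong (λ t → (t · α∨) ⊕ (b · y₀)) (equality N∣z₁) ⟨
      (proj₁ z · α∨) ⊕ (b · y₀)     ≡⟨ cong (_⊕ (b · y₀)) z≡z₁·α∨ ⟨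
      z ⊕ (b · y₀)                   ≡⟨ y-kw+kw≡y y b y₀ ⟩
      y                              ∎)
      where
      b = quotient (σy₀∣σ Ly)
      z = ((+ 1) · y) ⊕ ((- b) · y₀)

      σz≡0 : σ z ≡ 0ℤ
      σz≡0 = begin
        σ z                             ≡⟨ σ-linear (+ 1) y (- b) y₀ ⟩
        + 1 * σ y + - b * σ y₀          ≡⟨ cong (λ t → + 1 * t + - b * σ y₀) (equality (σy₀∣σ Ly)) ⟩
        + 1 * (b * σ y₀) + - b * σ y₀   ≡⟨ identity b (σ y₀) ⟩
        0ℤ                              ∎
        where
        identity : ∀ k s → + 1 * (k * s) + - k * s ≡ 0ℤ
        identity = solve-∀

      z≡z₁·α∨ : z ≡ proj₁ z · α∨
      z≡z₁·α∨ = σ≡0⇒≡·α∨ z σz≡0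

      N∣z₁ : N ∣ proj₁ z
      N∣z₁ = N∣ker (subst L z≡z₁·α∨ (closed (+ 1) (- b) Ly Ly₀))

      a = quotient N∣z₁

    independent : ∀ i j → (i · (N · α∨)) ⊕ (j · y₀) ≡ (+ 0 , + 0) → (i ≡ + 0) × (j ≡ + 0)
    independent i j combination≡0 = i*k≡0⇒i≡0 N≢0 iN≡0 , j≡0
      where
      jσy₀≡0 : j * σ y₀ ≡ 0ℤ
      jσy₀≡0 = begin
        j * σ y₀                          ≡⟨ ℤ.+-identityˡ (j * σ y₀) ⟨
        0ℤ + j * σ y₀                     ≡⟨ cong (λ t → t + j * σ y₀) (ℤ.*-zeroʳ i) ⟨
        i * 0ℤ + j * σ y₀                 ≡⟨ cong (λ t → i * t + j * σ y₀) (σ-α∨ N) ⟨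
        i * σ (N · α∨) + j * σ y₀         ≡⟨ σ-linear i (N · α∨) j y₀ ⟨
        σ ((i · (N · α∨)) ⊕ (j · y₀))    ≡⟨ cong σ combination≡0 ⟩
        0ℤ                                ∎

      j≡0 : j ≡ 0ℤ
      j≡0 = i*k≡0⇒i≡0 σy₀≢0 jσy₀≡0

      iN≡0 : i * N ≡ 0ℤ
      iN≡0 = begin
        i * N                              ≡⟨ identity i N (proj₁ y₀) ⟩
        i * (N * + 1) + 0ℤ * proj₁ y₀      ≡⟨ cong (λ t → i * (N * + 1) + t * proj₁ y₀) j≡0 ⟨
        i * (N * + 1) + j * proj₁ y₀       ≡⟨ cong proj₁ combination≡0 ⟩
        0ℤ                                 ∎
        where
        identity : ∀ i n a → i * n ≡ i * (n * + 1) + 0ℤ * a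
        identity = solve-∀

  least-positive-σ-divides : ∀ {k y₀} → L y₀ → σ y₀ ≡ + suc k →
    (∀ {j} → j ℕ.< k → ¬ σImage L (+ suc j)) → ∀ {y} → L y → σ y₀ ∣ σ y
  least-positive-σ-divides {k} {y₀} Ly₀ σy₀≡1+k minimal {y} Ly = byRemainder (σ y %ℕ suc k) refl
    where
    open ≡-Reasoning
    c = σ y /ℕ suc k
    z = ((+ 1) · y) ⊕ ((- c) · y₀)

    σz≡r : σ z ≡ + (σ y %ℕ suc k)
    σz≡r = begin
      σ z                                                     ≡⟨ σ-linear (+ 1) y (- c) y₀ ⟩
      + 1 * σ y + - c * σ y₀                                  ≡⟨ cong₂ (λ s t → + 1 * s + - c * t) (a≡a%ℕn+[a/ℕn]*n (σ y) (suc k)) σy₀≡1+k ⟩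
      + 1 * (+ (σ y %ℕ suc k) + c * + suc k) + - c * + suc k ≡⟨ identity (+ (σ y %ℕ suc k)) c (+ suc k) ⟩
      + (σ y %ℕ suc k)                                        ∎
      where
      identity : ∀ r q d → + 1 * (r + q * d) + - q * d ≡ r
      identity = solve-∀

    byRemainder : ∀ r → σ y %ℕ suc k ≡ r → σ y₀ ∣ σ y
    byRemainder zero r≡0 = divides c (begin
      σ y                                ≡⟨ a≡a%ℕn+[a/ℕn]*n (σ y) (suc k) ⟩
      + (σ y %ℕ suc k) + c * + suc k     ≡⟨ cong (λ r → + r + c * + suc k) r≡0 ⟩
      0ℤ + c * + suc k                   ≡⟨ ℤ.+-identityˡ (c * + suc k) ⟩
      c * + suc k                        ≡⟨ cong (c *_) σy₀≡1+k ⟨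
      c * σ y₀                           ∎)
    byRemainder (suc j) r≡1+j =
      contradiction (z , closed (+ 1) (- c) Ly Ly₀ , trans σz≡r (cong +_ r≡1+j))
        (minimal (ℕ.s<s⁻¹ (subst (ℕ._< suc k) r≡1+j (n%ℕd<d (σ y) (suc k)))))

module _ {L : Y → Set} (closed : LinearlyClosed L) (L? : ∀ y → Dec (L y))
         (M : ℕ) .{{_ : NonZero M}} (M·Y⊆L : ∀ y → L ((+ M) · y)) where

  σ-image? : ∀ s → Dec (σImage L s)
  σ-image? s = map′ fromResidue toResidue (any? λ (r : Fin M) → L? (+ toℕ r , s - + toℕ r))
    where
    fromResidue : (∃ λ (r : Fin M) → L (+ toℕ r , s - + toℕ r)) → σImage L s
    fromResidue (r , Ly) = _ , Ly , identity (+ toℕ r) s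
      where
      identity : ∀ r s → + 1 * r + + 1 * (s - r) ≡ s
      identity = solve-∀

    -- Subtracting a multiple of M α∨ reduces the first coordinate modulo M and keeps σ.
    toResidue : σImage L s → ∃ λ (r : Fin M) → L (+ toℕ r , s - + toℕ r)
    toResidue (y , Ly , σy≡s) = fromℕ< r<M ,
      subst L (trans (reduced {c = proj₁ y /ℕ M} {+ M} (a≡a%ℕn+[a/ℕn]*n (proj₁ y) M) σy≡s)
                     (cong (λ t → (+ t , s - + t)) (sym (toℕ-fromℕ< r<M))))
        (closed (+ 1) (- (proj₁ y /ℕ M)) Ly (M·Y⊆L α∨))
      where
      r<M = n%ℕd<d (proj₁ y) M

      reduced : ∀ {a b r c m s} → a ≡ r + c * m → + 1 * a + + 1 * b ≡ s →
        (+ 1 * a + - c * (m * + 1) , + 1 * b + - c * (m * - + 1)) ≡ (r , s - r)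
      reduced {b = b} {r} {c} {m} refl refl = cong₂ _,_ (identity₁ r c m) (identity₂ b r c m)
        where
        identity₁ : ∀ r c m → + 1 * (r + c * m) + - c * (m * + 1) ≡ r
        identity₁ = solve-∀
        identity₂ : ∀ b r c m → + 1 * b + - c * (m * - + 1) ≡ (+ 1 * (r + c * m) + + 1 * b) - r
        identity₂ = solve-∀

  M-1∈σImage : σImage L (+ suc (ℕ.pred M))
  M-1∈σImage = (+ M) · e₂ , M·Y⊆L e₂ , trans (identity (+ M)) (cong +_ (sym (ℕ.suc-pred M)))
    where
    identity : ∀ m → + 1 * (m * + 0) + + 1 * (m * + 1) ≡ m
    identity = solve-∀

  σ-generator : Σ Y λ y₀ → L y₀ × σ y₀ ≢ 0ℤ × (∀ {y} → L y → σ y₀ ∣ σ y)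
  σ-generator with least-witness (λ k → σ-image? (+ suc k)) M-1∈σImage
  ... | k , (y₀ , Ly₀ , σy₀≡1+k) , minimal =
    y₀ , Ly₀ , (λ σy₀≡0 → +[1+n]≢0 (trans (sym σy₀≡1+k) σy₀≡0)) ,
    least-positive-σ-divides closed Ly₀ σy₀≡1+k minimal

  α∨-multiple-extends-to-ℤBasis : ∀ {N} → L (N · α∨) → (∀ {z} → L (z · α∨) → N ∣ z) → N ≢ 0ℤ →
    Σ Y λ y₀ → L y₀ × IsℤBasis L (N · α∨) y₀
  α∨-multiple-extends-to-ℤBasis Lv N∣ker N≢0 =
    let y₀ , Ly₀ , σy₀≢0 , σy₀∣σ = σ-generator
    in y₀ , Ly₀ , isℤBasis-by-σ closed Lv Ly₀ N∣ker σy₀∣σ N≢0 σy₀≢0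

private instance
  gcd≢0ˡ : ∀ {m n} .{{_ : NonZero m}} → NonZero (gcd m n)
  gcd≢0ˡ {m} {n} = gcd-nonZero m n

module _ (m n : ℕ) .{{_ : NonZero m}} where

  private
    g = gcd m n
    m′ = m / g
    n′ = n / g

    m′*g≡m : m′ ℕ.* g ≡ m
    m′*g≡m = m/n*n≡m (gcd[m,n]∣m m n)

    n′*g≡n : n′ ℕ.* g ≡ n
    n′*g≡n = m/n*n≡m (gcd[m,n]∣n m n)

  ∣*⇒/gcd∣ : ∀ {k} → m ℕ.∣ k ℕ.* n → m / gcd m n ℕ.∣ k
  ∣*⇒/gcd∣ {k} m∣kn = coprime-divisor (coprime-/gcd m n) (ℕ.*-cancelʳ-∣ g
    (subst₂ ℕ._∣_ (sym m′*g≡m) (trans (cong (k ℕ.*_) (sym n′*g≡n)) (rearrange k n′ g)) m∣kn))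
    where
    rearrange : ∀ x y z → x ℕ.* (y ℕ.* z) ≡ y ℕ.* x ℕ.* z
    rearrange = ℕ-Solver.solve-∀

  /gcd∣⇒∣* : ∀ {k} → m / gcd m n ℕ.∣ k → m ℕ.∣ k ℕ.* n
  /gcd∣⇒∣* m′∣k = ℕ.∣-trans m∣m′n (ℕ.*-monoˡ-∣ n m′∣k)
    where
    rearrange : ∀ x y z → x ℕ.* (y ℕ.* z) ≡ y ℕ.* (x ℕ.* z)
    rearrange = ℕ-Solver.solve-∀

    m∣m′n : m ℕ.∣ m′ ℕ.* n
    m∣m′n = ℕ.divides n′ (trans (cong (m′ ℕ.*_) (sym n′*g≡n))
                               (trans (rearrange m′ n′ g) (cong (n′ ℕ.*_) m′*g≡m)))

+∣*⇔/gcd∣ : ∀ n c z .{{_ : NonZero n}} → (+ n ∣ z * c) ⇔ (+ (n / gcd n ∣ c ∣) ∣ z)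
+∣*⇔/gcd∣ n c z = mk⇔
  (λ n∣zc → ∣ᵤ⇒∣ (∣*⇒/gcd∣ n ∣ c ∣ (subst (n ℕ.∣_) (ℤ.abs-* z c) (∣⇒∣ᵤ n∣zc))))
  (λ n′∣z → ∣ᵤ⇒∣ (subst (n ℕ.∣_) (sym (ℤ.abs-* z c)) (/gcd∣⇒∣* n ∣ c ∣ (∣⇒∣ᵤ n′∣z))))

_∣ᵥ_ : ℤ → Y → Set
k ∣ᵥ (a , b) = (k ∣ a) × (k ∣ b)

_∣ᵥ?_ : ∀ k v → Dec (k ∣ᵥ v)
k ∣ᵥ? (a , b) = map′ ∣ᵤ⇒∣ ∣⇒∣ᵤ (∣ k ∣ ℕ.∣? ∣ a ∣) ×-dec map′ ∣ᵤ⇒∣ ∣⇒∣ᵤ (∣ k ∣ ℕ.∣? ∣ b ∣)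

∣ᵥ-linear : ∀ {k} i v j w → k ∣ᵥ v → k ∣ᵥ w → k ∣ᵥ ((i · v) ⊕ (j · w))
∣ᵥ-linear i _ j _ (k∣a , k∣b) (k∣c , k∣d) =
  ∣m∣n⇒∣m+n (∣n⇒∣m*n i k∣a) (∣n⇒∣m*n j k∣c) , ∣m∣n⇒∣m+n (∣n⇒∣m*n i k∣b) (∣n⇒∣m*n j k∣d)

∣ᵥ-· : ∀ k v → k ∣ᵥ (k · v)
∣ᵥ-· k (a , b) = ∣m⇒∣m*n a ∣-refl , ∣m⇒∣m*n b ∣-refl

∣ᵥ⇒∣∙ : ∀ {k} w v → k ∣ᵥ v → k ∣ w ∙ v
∣ᵥ⇒∣∙ (c , d) _ (k∣a , k∣b) = ∣m∣n⇒∣m+n (∣n⇒∣m*n c k∣a) (∣n⇒∣m*n d k∣b)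

∣ᵥ·α∨⇔∣ : ∀ k x → k ∣ᵥ (x · α∨) ⇔ k ∣ x
∣ᵥ·α∨⇔∣ k x = mk⇔ (λ (k∣x , _) → subst (k ∣_) (ℤ.*-identityʳ x) k∣x)
                  (λ k∣x → ∣m⇒∣m*n (+ 1) k∣x , ∣m⇒∣m*n (- + 1) k∣x)

module _ (p q : ℤ) where

  row₁ row₂ : Y
  row₁ = ((+ 2) * p , q)
  row₂ = (q , (+ 2) * p)

  gram : Y → Y
  gram y = (row₁ ∙ y , row₂ ∙ y)

  B≡∙gram : ∀ y w → B p q y w ≡ w ∙ gram y
  B≡∙gram (a , b) (c , d) = identity p q a b c d
    where
    identity : ∀ p q a b c d →
      (p * ((a + c) * (a + c)) + q * ((a + c) * (b + d)) + p * ((b + d) * (b + d)))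
        - (p * (a * a) + q * (a * b) + p * (b * b)) - (p * (c * c) + q * (c * d) + p * (d * d))
      ≡ c * ((+ 2) * p * a + q * b) + d * (q * a + (+ 2) * p * b)
    identity = solve-∀

  gram-linear : ∀ i y j z → gram ((i · y) ⊕ (j · z)) ≡ (i · gram y) ⊕ (j · gram z)
  gram-linear i y j z = cong₂ _,_ (∙-linear row₁ i y j z) (∙-linear row₂ i y j z)

  gram-· : ∀ k y → gram (k · y) ≡ k · gram y
  gram-· k y = cong₂ _,_ (∙-· row₁ k y) (∙-· row₂ k y)

  gram-α∨ : ∀ z → gram (z · α∨) ≡ (z * ((+ 2) * p - q)) · α∨
  gram-α∨ z = cong₂ _,_ (identity₁ p q z) (identity₂ p q z)
    where
    identity₁ : ∀ p q z → (+ 2) * p * (z * + 1) + q * (z * - + 1) ≡ z * ((+ 2) * p - q) * + 1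
    identity₁ = solve-∀
    identity₂ : ∀ p q z → q * (z * + 1) + (+ 2) * p * (z * - + 1) ≡ z * ((+ 2) * p - q) * - + 1
    identity₂ = solve-∀

  module _ (n : ℕ) .{{_ : NonZero n}} where

    Y[]⇒∣ᵥgram : ∀ y → Y[ p , q , n ] y → (+ n) ∣ᵥ gram y
    Y[]⇒∣ᵥgram y y∈Y[] =
      subst ((+ n) ∣_) (trans (B≡∙gram y e₁) (e₁∙ (gram y))) (∣ᵤ⇒∣ {+ n} {B p q y e₁} (y∈Y[] e₁)) ,
      subst ((+ n) ∣_) (trans (B≡∙gram y e₂) (e₂∙ (gram y))) (∣ᵤ⇒∣ {+ n} {B p q y e₂} (y∈Y[] e₂))

    ∣ᵥgram⇒Y[] : ∀ y → (+ n) ∣ᵥ gram y → Y[ p , q , n ] y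
    ∣ᵥgram⇒Y[] y n∣gram w =
      ∣⇒∣ᵤ {+ n} {B p q y w} (subst ((+ n) ∣_) (sym (B≡∙gram y w)) (∣ᵥ⇒∣∙ w (gram y) n∣gram))

    Y[]-linearlyClosed : LinearlyClosed Y[ p , q , n ]
    Y[]-linearlyClosed i j {y} {z} y∈Y[] z∈Y[] = ∣ᵥgram⇒Y[] ((i · y) ⊕ (j · z))
      (subst ((+ n) ∣ᵥ_) (sym (gram-linear i y j z))
        (∣ᵥ-linear i (gram y) j (gram z) (Y[]⇒∣ᵥgram y y∈Y[]) (Y[]⇒∣ᵥgram z z∈Y[])))

    Y[]? : ∀ y → Dec (Y[ p , q , n ] y)
    Y[]? y = map′ (∣ᵥgram⇒Y[] y) (Y[]⇒∣ᵥgram y) ((+ n) ∣ᵥ? gram y)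

    n·Y⊆Y[] : ∀ y → Y[ p , q , n ] ((+ n) · y)
    n·Y⊆Y[] y = ∣ᵥgram⇒Y[] ((+ n) · y) (subst ((+ n) ∣ᵥ_) (sym (gram-· (+ n) y)) (∣ᵥ-· (+ n) (gram y)))

    ·α∨∈Y[]⇒nα∣ : ∀ z → Y[ p , q , n ] (z · α∨) → + nα p q n ∣ z
    ·α∨∈Y[]⇒nα∣ z z·α∨∈Y[] = to (+∣*⇔/gcd∣ n ((+ 2) * p - q) z)
      (to (∣ᵥ·α∨⇔∣ (+ n) (z * ((+ 2) * p - q)))
        (subst ((+ n) ∣ᵥ_) (gram-α∨ z) (Y[]⇒∣ᵥgram (z · α∨) z·α∨∈Y[])))

    nα∣⇒·α∨∈Y[] : ∀ z → + nα p q n ∣ z → Y[ p , q , n ] (z · α∨)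
    nα∣⇒·α∨∈Y[] z nα∣z = ∣ᵥgram⇒Y[] (z · α∨)
      (subst ((+ n) ∣ᵥ_) (sym (gram-α∨ z))
        (from (∣ᵥ·α∨⇔∣ (+ n) (z * ((+ 2) * p - q))) (from (+∣*⇔/gcd∣ n ((+ 2) * p - q) z) nα∣z)))

lemma5p4p1 : (p q : ℤ) (n : ℕ) .{{_ : NonZero n}} →
    Σ Y λ yₒ → Y[ p , q , n ] yₒ × IsℤBasis Y[ p , q , n ] α∨[ p , q , n ] yₒ
lemma5p4p1 p q n =
  α∨-multiple-extends-to-ℤBasis (Y[]-linearlyClosed p q n) (Y[]? p q n) n (n·Y⊆Y[] p q n)
    (nα∣⇒·α∨∈Y[] p q n _ ∣-refl) (·α∨∈Y[]⇒nα∣ p q n _) nα≢0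
  where
  nα≢0 : + nα p q n ≢ 0ℤ
  nα≢0 nα≡0 = m/gcd[m,n]≢0 n ∣ (+ 2) * p - q ∣ (ℤ.+-injective nα≡0)
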